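{- Let $F_m$ be the Fibonacci numbers ($F_0=0$, $F_1=1$, $F_m=F_{m-1}+F_{m-2}$ for all integers $m$, so $F_{ -1}=1$). Let $b_0=\lambda_0=1$ and for $n\ge1$ let $b_n=3-\frac{1}{F_{2n-1}F_{2n-3}}$, $\lambda_n=1+\frac{1}{F_{2n-1}^2}$. Let $d_0=1$ and for $n\geq1$ let $d_{2n-1}=F_{2n-1}/F_{2n-3}$ and $d_{2n}=1/d_{2n-1}$. Then for all $n\geq0$, $\mathrm{Dyck}_n(d)=\mathrm{Mot}_n(b,\lambda)$.
   Context: A Motzkin path of length $n$ is a lattice path from $(0,0)$ to $(n,0)$ with steps $U=(1,1)$, $D=(1,-1)$, $H=(1,0)$ never going below the $x$-axis; a Dyck path of length $2n$ is a lattice path from $(0,0)$ to $(2n,0)$ with steps $U$ and $D$ never going below the $x$-axis. The height of a step is the $y$-coordinate of its ending point. The weight of a Motzkin path with respect to $(b,\lambda)$ is the product of $b_i$ over horizontal steps of height $i$ and $\lambda_i$ over down steps of height $i$; $\mathrm{Mot}_n(b,\lambda)$ is the sum of the weights of Motzkin paths of length $n$. The weight of a Dyck path with respect to $d$ is the product of $d_i$ over its down steps of height $i$; $\mathrm{Dyck}_n(d)$ is the sum of the weights of Dyck paths of length $2n$. -}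

module Defs where

open import Data.Nat as ℕ using (ℕ; zero; suc; _∸_; NonZero)
open import Data.Integer using (+_)
open import Data.Rational using (ℚ; 0ℚ; 1ℚ; _/_; _+_; _-_; _*_)
open import Data.List using (List; []; _∷_; map; concatMap; foldr)
open import Data.Bool using (Bool; true; false; if_then_else_)

fib : ℕ → ℕ
fib zero = 0
fib (suc zero) = 1
fib (suc (suc n)) = fib (suc n) ℕ.+ fib n

-- Fodd k = F_{2k-1}, with Fodd 0 = F_{-1} = 1
Fodd : ℕ → ℕ
Fodd zero = 1
Fodd (suc k) = fib (suc (k ℕ.+ k))

+-nz : ∀ a b → NonZero a → NonZero (a ℕ.+ b)
+-nz (suc a) b _ = _

fib-suc-nz : ∀ n → NonZero (fib (suc n))
fib-suc-nz zero = _
fib-suc-nz (suc n) = +-nz (fib (suc n)) (fib n) (fib-suc-nz n)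

Fodd-nz : ∀ k → NonZero (Fodd k)
Fodd-nz zero = _
Fodd-nz (suc k) = fib-suc-nz (k ℕ.+ k)

*-nz : ∀ a b → NonZero a → NonZero b → NonZero (a ℕ.* b)
*-nz (suc a) (suc b) _ _ = _

_over_,_ : ℕ → ℕ → ℕ → ℚ
m over i , j = _/_ (+ m) (Fodd i ℕ.* Fodd j) {{*-nz (Fodd i) (Fodd j) (Fodd-nz i) (Fodd-nz j)}}

ratio : ℕ → ℕ → ℚ
ratio i j = _/_ (+ Fodd i) (Fodd j) {{Fodd-nz j}}

3ℚ : ℚ
3ℚ = + 3 / 1

bSeq : ℕ → ℚ
bSeq zero = 1ℚ
bSeq (suc k) = 3ℚ - (1 over suc k , k)

lamSeq : ℕ → ℚ
lamSeq zero = 1ℚ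
lamSeq (suc k) = 1ℚ + (1 over suc k , suc k)

-- dFrom k m = d_{2k-1+m}  (k ≥ 1)
-- d_{2k-1} = F_{2k-1}/F_{2k-3},  d_{2k} = 1/d_{2k-1} = F_{2k-3}/F_{2k-1}
dFrom : ℕ → ℕ → ℚ
dFrom k zero = ratio k (k ∸ 1)
dFrom k (suc zero) = ratio (k ∸ 1) k
dFrom k (suc (suc m)) = dFrom (suc k) m

dSeq : ℕ → ℚ
dSeq zero = 1ℚ
dSeq (suc m) = dFrom 1 m

data Step : Set where
  U D H : Step

words : List Step → ℕ → List (List Step)
words A zero = [] ∷ []
words A (suc n) = concatMap (λ s → map (s ∷_) (words A n)) A

sumℚ : List ℚ → ℚ
sumℚ = foldr _+_ 0ℚ

validFrom : ℕ → List Step → Bool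
validFrom zero [] = true
validFrom (suc h) [] = false
validFrom h (U ∷ w) = validFrom (suc h) w
validFrom h (H ∷ w) = validFrom h w
validFrom zero (D ∷ w) = false
validFrom (suc h) (D ∷ w) = validFrom h w

motWeightFrom : (ℕ → ℚ) → (ℕ → ℚ) → ℕ → List Step → ℚ
motWeightFrom b lam h [] = 1ℚ
motWeightFrom b lam h (U ∷ w) = motWeightFrom b lam (suc h) w
motWeightFrom b lam h (H ∷ w) = b h * motWeightFrom b lam h w
motWeightFrom b lam zero (D ∷ w) = motWeightFrom b lam zero w -- never used for valid paths
motWeightFrom b lam (suc h) (D ∷ w) = lam h * motWeightFrom b lam h w

Mot : ℕ → (ℕ → ℚ) → (ℕ → ℚ) → ℚ
Mot n b lam = sumℚ (map (λ w → if validFrom 0 w then motWeightFrom b lam 0 w else 0ℚ) (words (U ∷ D ∷ H ∷ []) n))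

dyckWeightFrom : (ℕ → ℚ) → ℕ → List Step → ℚ
dyckWeightFrom d = motWeightFrom (λ _ → 0ℚ) d

Dyck : ℕ → (ℕ → ℚ) → ℚ
Dyck n d = sumℚ (map (λ w → if validFrom 0 w then dyckWeightFrom d 0 w else 0ℚ) (words (U ∷ D ∷ []) (n ℕ.+ n)))

-- Reading a Dyck path two steps at a time (UU ↦ U, DD ↦ D, UD and DU ↦ H)
-- halves its length and its heights and produces a Motzkin path, so Dyck
-- sums with weights d equal Motzkin sums with b_0 = d_0, b_k = d_{2k} + d_{2k-1}
-- and λ_k = d_{2k+1} d_{2k}, where d_i weights a down step ending at height i.
-- For the given d these are a/c + c/a and e a / c² for consecutive odd-index Fibonacci numbers
-- a, c, e, which reduce to b and λ through e + a = 3c, a² + c² + 1 = 3ac and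
-- e a = c² + 1.
module Submission where

open import Defs
open import Data.Nat as ℕ using (ℕ; zero; suc; NonZero)
open import Data.Nat.Properties using (m*n≢0; +-suc; +-comm)
open import Data.List using (List; []; _∷_; map; _++_; concat)
open import Function using (_∘_)
open import Relation.Binary.PropositionalEquality using (_≡_; refl; sym; trans; cong; cong₂; module ≡-Reasoning)

double : ℕ → ℕ
double zero = zero
double (suc k) = suc (suc (double k))

module OddFibonacci where

  open import Data.Nat using (_+_; _*_)
  open import Data.Nat.Properties using (+-suc; +-assoc; *-assoc; +-cancelˡ-≡)
  open import Data.Nat.Tactic.RingSolver using (solve; solve-∀)
  open ≡-Reasoning

  double≡+ : ∀ k → double k ≡ k + k
  double≡+ zero = refl
  double≡+ (suc k) = cong suc (trans (cong suc (double≡+ k)) (sym (+-suc k k)))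

  Fodd-double : ∀ k → Fodd (suc k) ≡ fib (suc (double k))
  Fodd-double k = cong (fib ∘ suc) (sym (double≡+ k))

  fib-skip : ∀ m → fib (suc (suc (suc (suc m)))) + fib m ≡ 3 * fib (suc (suc m))
  fib-skip m = regroup (fib (suc m)) (fib m)
    where
    regroup : ∀ x y → (((x + y) + x) + (x + y)) + y ≡ 3 * (x + y)
    regroup = solve-∀

  Fodd-recurrence : ∀ j → Fodd (suc (suc j)) + Fodd j ≡ 3 * Fodd (suc j)
  Fodd-recurrence zero = refl
  Fodd-recurrence (suc k) = begin
    Fodd (suc (suc (suc k))) + Fodd (suc k)  ≡⟨ cong₂ _+_ (Fodd-double (suc (suc k))) (Fodd-double k) ⟩
    fib (suc (suc (suc (suc m)))) + fib m     ≡⟨ fib-skip m ⟩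
    3 * fib (suc (suc m))                     ≡⟨ cong (3 *_) (sym (Fodd-double (suc k))) ⟩
    3 * Fodd (suc (suc k))                    ∎
    where m = suc (double k)

  markov⇒cassini : ∀ a c e → a * a + c * c + 1 ≡ 3 * (c * a) → e + a ≡ 3 * c → e * a ≡ c * c + 1
  markov⇒cassini a c e markov recurrence = +-cancelˡ-≡ (a * a) (e * a) (c * c + 1) (begin
    a * a + e * a      ≡⟨ solve (a ∷ e ∷ []) ⟩
    (e + a) * a        ≡⟨ cong (_* a) recurrence ⟩
    3 * c * a          ≡⟨ *-assoc 3 c a ⟩
    3 * (c * a)        ≡⟨ sym markov ⟩
    a * a + c * c + 1  ≡⟨ +-assoc (a * a) (c * c) 1 ⟩
    a * a + (c * c + 1) ∎)

  cassini⇒markov : ∀ a c e → e + a ≡ 3 * c → e * a ≡ c * c + 1 → c * c + e * e + 1 ≡ 3 * (e * c)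
  cassini⇒markov a c e recurrence cassini = begin
    c * c + e * e + 1    ≡⟨ solve (c ∷ e ∷ []) ⟩
    e * e + (c * c + 1)  ≡⟨ cong (e * e +_) (sym cassini) ⟩
    e * e + e * a        ≡⟨ solve (a ∷ e ∷ []) ⟩
    e * (e + a)          ≡⟨ cong (e *_) recurrence ⟩
    e * (3 * c)          ≡⟨ solve (c ∷ e ∷ []) ⟩
    3 * (e * c)          ∎

  Fodd-markov : ∀ j → Fodd j * Fodd j + Fodd (suc j) * Fodd (suc j) + 1 ≡ 3 * (Fodd (suc j) * Fodd j)
  Fodd-cassini : ∀ j → Fodd (suc (suc j)) * Fodd j ≡ Fodd (suc j) * Fodd (suc j) + 1

  Fodd-markov zero = refl
  Fodd-markov (suc j) = cassini⇒markov (Fodd j) (Fodd (suc j)) (Fodd (suc (suc j))) (Fodd-recurrence j) (Fodd-cassini j)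

  Fodd-cassini j = markov⇒cassini (Fodd j) (Fodd (suc j)) (Fodd (suc (suc j))) (Fodd-markov j) (Fodd-recurrence j)

module ClearedDenominators where

  open import Data.Nat using (_+_; _*_)
  open import Data.Nat.Tactic.RingSolver using (solve)
  open ≡-Reasoning

  -- The left-hand sides are the shapes to which the cross-multiplied ℚᵘ
  -- equations of markov⇒ratio-sum and cassini⇒ratio-product reduce.
  markov-cleared : ∀ a c → a * a + c * c + 1 ≡ 3 * (c * a) →
    ((a * a + c * c) * (c * a) + 1 * (c * a)) * 1 ≡ 3 * ((c * a) * (c * a))
  markov-cleared a c markov = begin
    ((a * a + c * c) * (c * a) + 1 * (c * a)) * 1  ≡⟨ solve (a ∷ c ∷ []) ⟩
    (a * a + c * c + 1) * (c * a)                   ≡⟨ cong (_* (c * a)) markov ⟩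
    3 * (c * a) * (c * a)                           ≡⟨ solve (a ∷ c ∷ []) ⟩
    3 * ((c * a) * (c * a))                         ∎

  cassini-cleared : ∀ e a c → e * a ≡ c * c + 1 → (e * a) * (1 * (c * c)) ≡ (1 * (c * c) + 1 * 1) * (c * c)
  cassini-cleared e a c cassini = begin
    (e * a) * (1 * (c * c))          ≡⟨ cong (λ x → x * (1 * (c * c))) cassini ⟩
    (c * c + 1) * (1 * (c * c))      ≡⟨ solve (c ∷ []) ⟩
    (1 * (c * c) + 1 * 1) * (c * c)  ∎

open OddFibonacci using (double≡+; Fodd-markov; Fodd-cassini)
open ClearedDenominators using (markov-cleared; cassini-cleared)

open import Data.Bool using (true; false; if_then_else_)
open import Data.List.Properties using (map-∘; map-cong; map-concatMap)
open import Data.Integer as ℤ using ()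
open import Data.Rational using (ℚ; 0ℚ; 1ℚ; _+_; _*_; _-_; _/_; toℚᵘ)
open import Data.Rational.Properties
  using (+-identityˡ; +-identityʳ; +-assoc; *-zeroʳ; *-distribˡ-+; +-0-group;
         toℚᵘ-injective; toℚᵘ-fromℚᵘ; toℚᵘ-homo-+; toℚᵘ-homo-*)
open import Data.Rational.Solver using (module +-*-Solver)
import Data.Rational.Unnormalised as ℚᵘ
import Data.Rational.Unnormalised.Properties as ℚᵘ
open import Algebra.Properties.Group +-0-group using (x≈z//y)

sumℚ-++ : ∀ xs ys → sumℚ (xs ++ ys) ≡ sumℚ xs + sumℚ ys
sumℚ-++ [] ys = sym (+-identityˡ _)
sumℚ-++ (x ∷ xs) ys = trans (cong (x +_) (sumℚ-++ xs ys)) (sym (+-assoc x _ _))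

sumℚ-concat : ∀ xss → sumℚ (concat xss) ≡ sumℚ (map sumℚ xss)
sumℚ-concat [] = refl
sumℚ-concat (xs ∷ xss) = trans (sumℚ-++ xs (concat xss)) (cong (sumℚ xs +_) (sumℚ-concat xss))

sumℚ-map-* : ∀ {A : Set} c (f : A → ℚ) xs → sumℚ (map (λ x → c * f x) xs) ≡ c * sumℚ (map f xs)
sumℚ-map-* c f [] = sym (*-zeroʳ c)
sumℚ-map-* c f (x ∷ xs) = trans (cong (c * f x +_) (sumℚ-map-* c f xs)) (sym (*-distribˡ-+ c (f x) _))

sumℚ-map-0 : ∀ {A : Set} (xs : List A) → sumℚ (map (λ _ → 0ℚ) xs) ≡ 0ℚ
sumℚ-map-0 [] = refl
sumℚ-map-0 (x ∷ xs) = cong (0ℚ +_) (sumℚ-map-0 xs)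

if-*ʳ : ∀ b c x → (if b then c * x else 0ℚ) ≡ c * (if b then x else 0ℚ)
if-*ʳ true c x = refl
if-*ʳ false c x = sym (*-zeroʳ c)

pathWeight : (ℕ → ℚ) → (ℕ → ℚ) → ℕ → List Step → ℚ
pathWeight b lam h w = if validFrom h w then motWeightFrom b lam h w else 0ℚ

pathSum : List Step → (ℕ → ℚ) → (ℕ → ℚ) → ℕ → ℕ → ℚ
pathSum A b lam n h = sumℚ (map (pathWeight b lam h) (words A n))

firstStepSum : List Step → (ℕ → ℚ) → (ℕ → ℚ) → ℕ → ℕ → Step → ℚ
firstStepSum A b lam n h U = pathSum A b lam n (suc h)
firstStepSum A b lam n h H = b h * pathSum A b lam n h
firstStepSum A b lam n zero D = 0ℚ
firstStepSum A b lam n (suc h) D = lam h * pathSum A b lam n h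

pathWeight-H : ∀ b lam h w → pathWeight b lam h (H ∷ w) ≡ b h * pathWeight b lam h w
pathWeight-H b lam zero w = if-*ʳ (validFrom zero w) (b zero) _
pathWeight-H b lam (suc h) w = if-*ʳ (validFrom (suc h) w) (b (suc h)) _

sumℚ-paths-starting-with : ∀ A b lam n h s →
  sumℚ (map (pathWeight b lam h) (map (s ∷_) (words A n))) ≡ firstStepSum A b lam n h s
sumℚ-paths-starting-with A b lam n h s = trans (cong sumℚ (sym (map-∘ ws))) (go h s)
  where
  ws = words A n
  go : ∀ h s → sumℚ (map (pathWeight b lam h ∘ (s ∷_)) ws) ≡ firstStepSum A b lam n h s
  go zero U = refl
  go (suc h) U = refl
  go h H = trans (cong sumℚ (map-cong (pathWeight-H b lam h) ws)) (sumℚ-map-* (b h) (pathWeight b lam h) ws)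
  go zero D = sumℚ-map-0 ws
  go (suc h) D = trans (cong sumℚ (map-cong (λ w → if-*ʳ (validFrom h w) (lam h) _) ws))
    (sumℚ-map-* (lam h) (pathWeight b lam h) ws)

pathSum-suc : ∀ A b lam n h → pathSum A b lam (suc n) h ≡ sumℚ (map (firstStepSum A b lam n h) A)
pathSum-suc A b lam n h = begin
  sumℚ (map f (concat (map (λ s → map (s ∷_) ws) A)))
    ≡⟨ cong sumℚ (map-concatMap f (λ s → map (s ∷_) ws) A) ⟩
  sumℚ (concat (map (map f ∘ λ s → map (s ∷_) ws) A))
    ≡⟨ sumℚ-concat (map (map f ∘ λ s → map (s ∷_) ws) A) ⟩
  sumℚ (map sumℚ (map (map f ∘ λ s → map (s ∷_) ws) A))
    ≡⟨ cong sumℚ (sym (map-∘ A)) ⟩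
  sumℚ (map (λ s → sumℚ (map f (map (s ∷_) ws))) A)
    ≡⟨ cong sumℚ (map-cong (sumℚ-paths-starting-with A b lam n h) A) ⟩
  sumℚ (map (firstStepSum A b lam n h) A) ∎
  where
  open ≡-Reasoning
  f = pathWeight b lam h
  ws = words A n

motzkinSteps dyckSteps : List Step
motzkinSteps = U ∷ D ∷ H ∷ []
dyckSteps = U ∷ D ∷ []

motzkinSum-suc : ∀ b lam n h →
  pathSum motzkinSteps b lam (suc n) h
    ≡ pathSum motzkinSteps b lam n (suc h) + firstStepSum motzkinSteps b lam n h D + b h * pathSum motzkinSteps b lam n h
motzkinSum-suc b lam n h = trans (pathSum-suc motzkinSteps b lam n h)
  (trans (cong (λ z → up + (down + z)) (+-identityʳ level)) (sym (+-assoc up down level)))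
  where
  up = firstStepSum motzkinSteps b lam n h U
  down = firstStepSum motzkinSteps b lam n h D
  level = firstStepSum motzkinSteps b lam n h H

dyckSum-suc : ∀ d m h →
  pathSum dyckSteps (λ _ → 0ℚ) d (suc m) h
    ≡ pathSum dyckSteps (λ _ → 0ℚ) d m (suc h) + firstStepSum dyckSteps (λ _ → 0ℚ) d m h D
dyckSum-suc d m h = trans (pathSum-suc dyckSteps (λ _ → 0ℚ) d m h)
  (cong (pathSum dyckSteps (λ _ → 0ℚ) d m (suc h) +_) (+-identityʳ (firstStepSum dyckSteps (λ _ → 0ℚ) d m h D)))

dyck-contraction : ∀ b lam d → b 0 ≡ d 0 →
  (∀ j → b (suc j) ≡ d (suc (suc (double j))) + d (suc (double j))) →
  (∀ j → lam j ≡ d (suc (double j)) * d (double j)) →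
  ∀ n k → pathSum dyckSteps (λ _ → 0ℚ) d (double n) (double k) ≡ pathSum motzkinSteps b lam n k
dyck-contraction b lam d b₀ bₛ lamₛ = contract
  where
  open ≡-Reasoning
  Dy = pathSum dyckSteps (λ _ → 0ℚ) d
  Mo = pathSum motzkinSteps b lam
  contract : ∀ n k → Dy (double n) (double k) ≡ Mo n k
  contract zero zero = refl
  contract zero (suc k) = refl
  contract (suc n) zero = begin
    Dy (suc (suc (double n))) 0
      ≡⟨ trans (dyckSum-suc d (suc (double n)) 0) (+-identityʳ (Dy (suc (double n)) 1)) ⟩
    Dy (suc (double n)) 1
      ≡⟨ dyckSum-suc d (double n) 1 ⟩
    Dy (double n) 2 + d 0 * Dy (double n) 0
      ≡⟨ cong₂ (λ x y → x + d 0 * y) (contract n 1) (contract n 0) ⟩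
    Mo n 1 + d 0 * Mo n 0
      ≡⟨ cong₂ (λ x y → x + y * Mo n 0) (sym (+-identityʳ (Mo n 1))) (sym b₀) ⟩
    Mo n 1 + 0ℚ + b 0 * Mo n 0
      ≡⟨ sym (motzkinSum-suc b lam n 0) ⟩
    Mo (suc n) 0 ∎
  contract (suc n) (suc j) = begin
    Dy (suc (suc (double n))) (suc (suc (double j)))
      ≡⟨ dyckSum-suc d (suc (double n)) (suc (suc (double j))) ⟩
    Dy (suc (double n)) (suc (suc (suc (double j)))) + d₁ * Dy (suc (double n)) (suc (double j))
      ≡⟨ cong₂ (λ x y → x + d₁ * y) (dyckSum-suc d (double n) (suc (suc (suc (double j)))))
                                    (dyckSum-suc d (double n) (suc (double j))) ⟩
    (Dy (double n) (suc (suc (suc (suc (double j))))) + d₂ * Dy (double n) (suc (suc (double j))))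
      + d₁ * (Dy (double n) (suc (suc (double j))) + d₀ * Dy (double n) (double j))
      ≡⟨ cong₂ (λ x y → (x + d₂ * y) + d₁ * (y + d₀ * Dy (double n) (double j)))
               (contract n (suc (suc j))) (contract n (suc j)) ⟩
    (Mo n (suc (suc j)) + d₂ * Mo n (suc j)) + d₁ * (Mo n (suc j) + d₀ * Dy (double n) (double j))
      ≡⟨ cong (λ z → (Mo n (suc (suc j)) + d₂ * Mo n (suc j)) + d₁ * (Mo n (suc j) + d₀ * z))
              (contract n j) ⟩
    (Mo n (suc (suc j)) + d₂ * Mo n (suc j)) + d₁ * (Mo n (suc j) + d₀ * Mo n j)
      ≡⟨ regroup (Mo n (suc (suc j))) (Mo n (suc j)) (Mo n j) d₂ d₁ d₀ ⟩
    Mo n (suc (suc j)) + (d₁ * d₀) * Mo n j + (d₂ + d₁) * Mo n (suc j)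
      ≡⟨ cong₂ (λ x y → Mo n (suc (suc j)) + x * Mo n j + y * Mo n (suc j)) (sym (lamₛ j)) (sym (bₛ j)) ⟩
    Mo n (suc (suc j)) + lam j * Mo n j + b (suc j) * Mo n (suc j)
      ≡⟨ sym (motzkinSum-suc b lam n (suc j)) ⟩
    Mo (suc n) (suc j) ∎
    where
    d₀ = d (double j)
    d₁ = d (suc (double j))
    d₂ = d (suc (suc (double j)))
    regroup : ∀ x y z p q r → (x + p * y) + q * (y + r * z) ≡ x + (q * r) * z + (p + q) * y
    regroup = solve 6 (λ x y z p q r →
      (x :+ p :* y) :+ q :* (y :+ r :* z) := x :+ (q :* r) :* z :+ (p :+ q) :* y) refl
      where open +-*-Solver

toℚᵘ-/ : ∀ n d .{{_ : NonZero d}} → toℚᵘ (ℤ.+ n / d) ℚᵘ.≃ (ℤ.+ n ℚᵘ./ d)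
toℚᵘ-/ n (suc d) = toℚᵘ-fromℚᵘ (ℤ.+ n ℚᵘ./ suc d)

markov⇒ratio-sum : ∀ a c .{{_ : NonZero a}} .{{_ : NonZero c}} →
  a ℕ.* a ℕ.+ c ℕ.* c ℕ.+ 1 ≡ 3 ℕ.* (c ℕ.* a) →
  ℤ.+ a / c + ℤ.+ c / a ≡ 3ℚ - (ℤ.+ 1 / (c ℕ.* a)) {{m*n≢0 c a}}
markov⇒ratio-sum a@(suc _) c@(suc _) markov = x≈z//y _ _ _ (toℚᵘ-injective (begin
  toℚᵘ (ℤ.+ a / c + ℤ.+ c / a + ℤ.+ 1 / (c ℕ.* a))
    ≈⟨ ℚᵘ.≃-trans (toℚᵘ-homo-+ (ℤ.+ a / c + ℤ.+ c / a) (ℤ.+ 1 / (c ℕ.* a)))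
         (ℚᵘ.+-cong (ℚᵘ.≃-trans (toℚᵘ-homo-+ (ℤ.+ a / c) (ℤ.+ c / a)) (ℚᵘ.+-cong (toℚᵘ-/ a c) (toℚᵘ-/ c a))) (toℚᵘ-/ 1 (c ℕ.* a))) ⟩
  ℤ.+ a ℚᵘ./ c ℚᵘ.+ ℤ.+ c ℚᵘ./ a ℚᵘ.+ ℤ.+ 1 ℚᵘ./ (c ℕ.* a)
    ≈⟨ ℚᵘ.*≡* (cong ℤ.+_ (markov-cleared a c markov)) ⟩
  toℚᵘ 3ℚ ∎))
  where open ℚᵘ.≃-Reasoning

cassini⇒ratio-product : ∀ e a c .{{_ : NonZero e}} .{{_ : NonZero a}} .{{_ : NonZero c}} →
  e ℕ.* a ≡ c ℕ.* c ℕ.+ 1 →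
  (ℤ.+ e / c) * (ℤ.+ a / c) ≡ 1ℚ + (ℤ.+ 1 / (c ℕ.* c)) {{m*n≢0 c c}}
cassini⇒ratio-product e@(suc _) a@(suc _) c@(suc _) cassini = toℚᵘ-injective (begin
  toℚᵘ ((ℤ.+ e / c) * (ℤ.+ a / c))
    ≈⟨ ℚᵘ.≃-trans (toℚᵘ-homo-* (ℤ.+ e / c) (ℤ.+ a / c)) (ℚᵘ.*-cong (toℚᵘ-/ e c) (toℚᵘ-/ a c)) ⟩
  (ℤ.+ e ℚᵘ./ c) ℚᵘ.* (ℤ.+ a ℚᵘ./ c)
    ≈⟨ ℚᵘ.*≡* (cong ℤ.+_ (cassini-cleared e a c cassini)) ⟩
  ℚᵘ.1ℚᵘ ℚᵘ.+ ℤ.+ 1 ℚᵘ./ (c ℕ.* c)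
    ≈⟨ ℚᵘ.≃-sym (ℚᵘ.≃-trans (toℚᵘ-homo-+ 1ℚ (ℤ.+ 1 / (c ℕ.* c))) (ℚᵘ.+-cong ℚᵘ.≃-refl (toℚᵘ-/ 1 (c ℕ.* c)))) ⟩
  toℚᵘ (1ℚ + ℤ.+ 1 / (c ℕ.* c)) ∎)
  where open ℚᵘ.≃-Reasoning

dFrom-double : ∀ k j → dFrom k (double j) ≡ dFrom (j ℕ.+ k) 0
dFrom-double k zero = refl
dFrom-double k (suc j) = trans (dFrom-double (suc k) j) (cong (λ i → dFrom i 0) (+-suc j k))

dFrom-suc-double : ∀ k j → dFrom k (suc (double j)) ≡ dFrom (j ℕ.+ k) 1
dFrom-suc-double k zero = refl
dFrom-suc-double k (suc j) = trans (dFrom-suc-double (suc k) j) (cong (λ i → dFrom i 1) (+-suc j k))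

dSeq-odd : ∀ j → dSeq (suc (double j)) ≡ ratio (suc j) j
dSeq-odd j = trans (dFrom-double 1 j) (cong (λ i → dFrom i 0) (+-comm j 1))

dSeq-even : ∀ j → dSeq (suc (suc (double j))) ≡ ratio j (suc j)
dSeq-even j = trans (dFrom-suc-double 1 j) (cong (λ i → dFrom i 1) (+-comm j 1))

bSeq-contraction : ∀ j → bSeq (suc j) ≡ dSeq (suc (suc (double j))) + dSeq (suc (double j))
bSeq-contraction j = begin
  bSeq (suc j)
    ≡⟨ sym (markov⇒ratio-sum (Fodd j) (Fodd (suc j)) {{Fodd-nz j}} {{Fodd-nz (suc j)}} (Fodd-markov j)) ⟩
  ratio j (suc j) + ratio (suc j) j
    ≡⟨ sym (cong₂ _+_ (dSeq-even j) (dSeq-odd j)) ⟩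
  dSeq (suc (suc (double j))) + dSeq (suc (double j)) ∎
  where open ≡-Reasoning

lamSeq-contraction : ∀ j → lamSeq j ≡ dSeq (suc (double j)) * dSeq (double j)
lamSeq-contraction zero = refl
lamSeq-contraction (suc i) = begin
  lamSeq (suc i)
    ≡⟨ sym (cassini⇒ratio-product (Fodd (suc (suc i))) (Fodd i) (Fodd (suc i))
              {{Fodd-nz (suc (suc i))}} {{Fodd-nz i}} {{Fodd-nz (suc i)}} (Fodd-cassini i)) ⟩
  ratio (suc (suc i)) (suc i) * ratio i (suc i)
    ≡⟨ sym (cong₂ _*_ (dSeq-odd (suc i)) (dSeq-even i)) ⟩
  dSeq (suc (double (suc i))) * dSeq (double (suc i)) ∎
  where open ≡-Reasoning

corollary2p3 : (n : ℕ) → Dyck n dSeq ≡ Mot n bSeq lamSeq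
corollary2p3 n = begin
  Dyck n dSeq
    ≡⟨ cong (λ m → pathSum dyckSteps (λ _ → 0ℚ) dSeq m 0) (sym (double≡+ n)) ⟩
  pathSum dyckSteps (λ _ → 0ℚ) dSeq (double n) 0
    ≡⟨ dyck-contraction bSeq lamSeq dSeq refl bSeq-contraction lamSeq-contraction n 0 ⟩
  Mot n bSeq lamSeq ∎
  where open ≡-Reasoning
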